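{- Let $G$ be a finite bipartite graph with bipartition $A\cup B$, and let $(A_1,B_1),\dots,(A_k,B_k)$ be the pairs constructed by the KM algorithm. Then for every $i$ the induced subgraph $G[A_i\cup B_i]$ is connected.
   Context: The KM algorithm (Körner–Marton) is defined as follows. Let $G$ be a finite bipartite graph with bipartition $A\cup B$, and for $S\subseteq A$ let $N(S)$ denote its neighbourhood in the current graph. The pairs are built iteratively. Suppose $(A_1,B_1),\dots,(A_{i-1},B_{i-1})$ have been chosen, and let $G_i=G-A_1-B_1-\dots-A_{i-1}-B_{i-1}$ with parts $A\setminus(A_1\cup\dots\cup A_{i-1})$ and $B\setminus(B_1\cup\dots\cup B_{i-1})$. - If the $A$-part of $G_i$ contains a vertex $a$ that is isolated in $G$, set $A_i=\{a\}$ and $B_i=\varnothing$ (ratio $+\infty$). - Otherwise, if the $A$-part of $G_i$ is nonempty, choose a nonempty $A_i$ in the $A$-part of $G_i$ maximizing the ratio $|A_i|/|N(A_i)|$, where $N$ is taken in $G_i$. Among the maximizers, take $A_i$ inclusion-wise minimal, and set $B_i=N(A_i)$. - Once the $A$-part is exhausted, every remaining vertex $b$ of $B$ (these are isolated in $G$) forms its own pair $A_i=\varnothing$, $B_i=\{b\}$. -}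

module Defs where

open import Data.Nat using (ℕ; zero; suc; _*_; _≤_; _<_)
open import Data.Bool using (Bool; true; false; _∧_; _∨_; T)
open import Data.Fin using (Fin; zero; suc)
open import Data.Fin.Subset using (Subset; _∈_; _∉_; _⊆_; _⊂_; ∣_∣; Nonempty; Empty; ⁅_⁆; _─_; ⊥)
open import Data.Vec using (lookup; tabulate)
open import Data.Sum using (_⊎_; inj₁; inj₂)
open import Data.Product using (_×_; _,_; Σ)
open import Data.List using (List; []; _∷_)
open import Data.Empty renaming (⊥ to Void)
open import Relation.Nullary using (¬_)

BipGraph : ℕ → ℕ → Set
BipGraph m n = Fin m → Fin n → Bool

anyFin : ∀ {m} → (Fin m → Bool) → Bool
anyFin {zero}  f = false
anyFin {suc m} f = f zero ∨ anyFin (λ i → f (suc i))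

-- Neighbourhood of S ⊆ A in the current graph G_i, whose B-part is remB:
-- N(S) = { b ∈ remB | ∃ a ∈ S, ab ∈ E }.
Nbhd : ∀ {m n} → BipGraph m n → Subset n → Subset m → Subset n
Nbhd E remB S = tabulate (λ b → lookup remB b ∧ anyFin (λ a → lookup S a ∧ E a b))

IsolatedA : ∀ {m n} → BipGraph m n → Fin m → Set
IsolatedA E a = ∀ b → ¬ T (E a b)

-- S has ratio |S|/|N(S)| at least that of T (cross-multiplied; N = ∅ means ratio +∞).
-- Both S and T are assumed nonempty where used.
RatioGE : ∀ {m n} → BipGraph m n → Subset n → Subset m → Subset m → Set
RatioGE E remB S T = ∣ T ∣ * ∣ Nbhd E remB S ∣ ≤ ∣ S ∣ * ∣ Nbhd E remB T ∣

-- KMRun E remA remB ps : ps is a possible output (list of pairs (A_i , B_i))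
-- of the KM algorithm started on the graph G_i whose parts are remA, remB.
data KMRun {m n} (E : BipGraph m n) : Subset m → Subset n → List (Subset m × Subset n) → Set where
  done : ∀ {remA remB} → Empty remA → Empty remB → KMRun E remA remB []
  isoStep : ∀ {remA remB ps} (a : Fin m) → a ∈ remA → IsolatedA E a →
            KMRun E (remA ─ ⁅ a ⁆) remB ps →
            KMRun E remA remB ((⁅ a ⁆ , ⊥) ∷ ps)
  ratioStep : ∀ {remA remB ps} (S : Subset m) →
            (∀ a → a ∈ remA → ¬ IsolatedA E a) →
            S ⊆ remA → Nonempty S →
            (∀ T → T ⊆ remA → Nonempty T → RatioGE E remB S T) →
            (∀ T → T ⊂ S → Nonempty T → ¬ RatioGE E remB T S) →
            KMRun E (remA ─ S) (remB ─ Nbhd E remB S) ps →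
            KMRun E remA remB ((S , Nbhd E remB S) ∷ ps)
  bStep : ∀ {remA remB ps} (b : Fin n) → Empty remA → b ∈ remB →
            KMRun E remA (remB ─ ⁅ b ⁆) ps →
            KMRun E remA remB ((⊥ , ⁅ b ⁆) ∷ ps)

IsKMOutput : ∀ {m n} → BipGraph m n → List (Subset m × Subset n) → Set
IsKMOutput {m} {n} E ps = KMRun E Data.Fin.Subset.⊤ Data.Fin.Subset.⊤ ps

Vertex : ℕ → ℕ → Set
Vertex m n = Fin m ⊎ Fin n

Adj : ∀ {m n} → BipGraph m n → Vertex m n → Vertex m n → Set
Adj E (inj₁ a) (inj₂ b) = T (E a b)
Adj E (inj₂ b) (inj₁ a) = T (E a b)
Adj E _ _ = Void

InVS : ∀ {m n} → Subset m → Subset n → Vertex m n → Set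
InVS X Y (inj₁ a) = a ∈ X
InVS X Y (inj₂ b) = b ∈ Y

data Walk {m n} (E : BipGraph m n) (X : Subset m) (Y : Subset n) : Vertex m n → Vertex m n → Set where
  here : ∀ {u} → InVS X Y u → Walk E X Y u u
  step : ∀ {u v w} → InVS X Y u → Adj E u v → Walk E X Y v w → Walk E X Y u w

InducedConnected : ∀ {m n} → BipGraph m n → Subset m → Subset n → Set
InducedConnected E X Y = ∀ u v → InVS X Y u → InVS X Y v → Walk E X Y u v

module Submission where

-- Pairs produced by the isolated-vertex steps are single vertices.  For a pair
-- produced by a ratio step, S = A_i is a nonempty set which maximises
-- |S| / |N(S)| and is inclusion-minimal with this property, and B_i = N(S).
-- The key fact ('unsplittable') is that such an S cannot be partitioned into
-- two nonempty parts R and S ─ R with disjoint neighbourhoods: by minimality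
-- both parts have a strictly smaller ratio than S, which is impossible since
-- |S| / |N(S)| is then the mediant of their two ratios.  Connectivity follows by growing,
-- from a vertex a of S, the set C of vertices of S reachable from a (by
-- saturating under "share a neighbour with C").  The saturated set C and
-- S ─ C have disjoint neighbourhoods, so S ─ C is empty.

open import Defs
open import Data.Nat using (ℕ; zero; suc; _+_; _*_; _≤_; _<_)
open import Data.Nat.Properties
  using (+-suc; +-monoʳ-≤; m≤m+n; ≤-antisym; ≰⇒>; +-mono-<; *-distribʳ-+; *-distribˡ-+; <-irrefl; module ≤-Reasoning)
open import Data.Bool using (Bool; true; false; T; _∧_)
open import Data.Bool.Properties using (T-≡; T-∧; T-∨)
open import Data.Empty using (⊥; ⊥-elim)
open import Data.Fin using (Fin; zero; suc)
open import Data.Fin.Properties using (any?)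
open import Data.Fin.Subset
  using (Subset; _⊆_; _⊂_; ∣_∣; Nonempty; ⁅_⁆; _─_; _∪_)
  renaming (_∈_ to _∈ₛ_; _∉_ to _∉ₛ_; ⊥ to ∅)
open import Data.Fin.Subset.Properties
  using (_∈?_; drop-∷-⊆; x∈p∪q⁻; p⊆p∪q; q⊆p∪q; p─q⊆p; x∈p∧x∉q⇒x∈p─q; x∈⁅x⁆; x∈⁅y⁆⇒x≡y; ∉⊥;
         ⊆-antisym; ∣p∣≡n⇒p≡⊤; ∣p∣≤n; p⊂q⇒∣p∣<∣q∣; ∈⊤)
open import Data.Vec using ([]; _∷_; lookup; tabulate; here; there)
open import Data.Vec.Properties using ([]=⇒lookup; lookup⇒[]=; lookup∘tabulate)
open import Data.Sum using (inj₁; inj₂)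
open import Data.Product using (_×_; _,_; ∃)
open import Data.List using (List)
open import Data.List.Membership.Propositional using (_∈_)
open import Data.List.Relation.Unary.Any using (here; there)
open import Function using (_∘_; flip)
open import Function.Bundles using (Equivalence)
open import Relation.Binary.PropositionalEquality using (_≡_; refl; sym; trans; cong; subst)
open import Relation.Nullary using (¬_; Dec; yes; no; ¬?; _×-dec_)
open import Relation.Nullary.Decidable using (decidable-stable)

open Equivalence using (to; from)

∈⇒T : ∀ {k} {p : Subset k} {x} → x ∈ₛ p → T (lookup p x)
∈⇒T x∈p = from T-≡ ([]=⇒lookup x∈p)

T⇒∈ : ∀ {k} {p : Subset k} {x} → T (lookup p x) → x ∈ₛ p
T⇒∈ {p = p} {x} t = lookup⇒[]= x p (to T-≡ t)

∈-tabulate⁺ : ∀ {k} (f : Fin k → Bool) {x} → T (f x) → x ∈ₛ tabulate f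
∈-tabulate⁺ f {x} t = T⇒∈ (subst T (sym (lookup∘tabulate f x)) t)

∈-tabulate⁻ : ∀ {k} (f : Fin k → Bool) {x} → x ∈ₛ tabulate f → T (f x)
∈-tabulate⁻ f {x} x∈ = subst T (lookup∘tabulate f x) (∈⇒T x∈)

anyFin⁺ : ∀ {k} (f : Fin k → Bool) {i} → T (f i) → T (anyFin f)
anyFin⁺ {suc k} f {zero}  t = from T-∨ (inj₁ t)
anyFin⁺ {suc k} f {suc i} t = from (T-∨ {f zero}) (inj₂ (anyFin⁺ (f ∘ suc) t))

anyFin⁻ : ∀ {k} (f : Fin k → Bool) → T (anyFin f) → ∃ λ i → T (f i)
anyFin⁻ {suc k} f t with to (T-∨ {f zero}) t
... | inj₁ t₀ = zero , t₀
... | inj₂ tₛ with anyFin⁻ (f ∘ suc) tₛ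
...   | i , tᵢ = suc i , tᵢ

x∈p─q⇒x∉q : ∀ {k} {p q : Subset k} {x} → x ∈ₛ p ─ q → x ∉ₛ q
x∈p─q⇒x∉q {p = true  ∷ p} {false ∷ q} here        ()
x∈p─q⇒x∉q {p = _     ∷ p} {_     ∷ q} (there x∈) (there x∈q) = x∈p─q⇒x∉q x∈ x∈q

Nbhd⁺ : ∀ {m n} (E : BipGraph m n) (Y : Subset n) {S a b} → b ∈ₛ Y → a ∈ₛ S → T (E a b) → b ∈ₛ Nbhd E Y S
Nbhd⁺ E Y {S} {a} {b} b∈Y a∈S eab =
  ∈-tabulate⁺ _ (from T-∧ (∈⇒T b∈Y , anyFin⁺ (λ a′ → lookup S a′ ∧ E a′ b) (from T-∧ (∈⇒T a∈S , eab))))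

Nbhd⁻ : ∀ {m n} (E : BipGraph m n) (Y : Subset n) {S b} → b ∈ₛ Nbhd E Y S → b ∈ₛ Y × ∃ λ a → a ∈ₛ S × T (E a b)
Nbhd⁻ E Y {S} {b} b∈N with to T-∧ (∈-tabulate⁻ _ b∈N)
... | tb , t with anyFin⁻ (λ a → lookup S a ∧ E a b) t
... | a , t′ with to T-∧ t′
... | ta , eab = T⇒∈ tb , a , T⇒∈ ta , eab

Nbhd-mono : ∀ {m n} (E : BipGraph m n) (Y : Subset n) {S S′} → S ⊆ S′ → Nbhd E Y S ⊆ Nbhd E Y S′
Nbhd-mono E Y S⊆S′ b∈N with Nbhd⁻ E Y b∈N
... | b∈Y , a , a∈S , eab = Nbhd⁺ E Y b∈Y (S⊆S′ a∈S) eab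

Nbhd-difference : ∀ {m n} (E : BipGraph m n) (Y : Subset n) {S R} →
  (∀ {b} → b ∈ₛ Nbhd E Y R → b ∈ₛ Nbhd E Y (S ─ R) → ⊥) →
  Nbhd E Y (S ─ R) ≡ Nbhd E Y S ─ Nbhd E Y R
Nbhd-difference E Y {S} {R} disjoint = ⊆-antisym into onto
  where
  into : Nbhd E Y (S ─ R) ⊆ Nbhd E Y S ─ Nbhd E Y R
  into b∈ = x∈p∧x∉q⇒x∈p─q (Nbhd-mono E Y (p─q⊆p S R) b∈) (λ b∈NR → disjoint b∈NR b∈)

  onto : Nbhd E Y S ─ Nbhd E Y R ⊆ Nbhd E Y (S ─ R)
  onto {b} b∈ with Nbhd⁻ E Y (p─q⊆p (Nbhd E Y S) (Nbhd E Y R) b∈)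
  ... | b∈Y , a , a∈S , eab with a ∈? R
  ...   | yes a∈R = ⊥-elim (x∈p─q⇒x∉q b∈ (Nbhd⁺ E Y b∈Y a∈R eab))
  ...   | no  a∉R = Nbhd⁺ E Y {S ─ R} b∈Y (x∈p∧x∉q⇒x∈p─q a∈S a∉R) eab

module _ {m n} {E : BipGraph m n} {X : Subset m} {Y : Subset n} where

  walk-start : ∀ {u v} → Walk E X Y u v → InVS X Y u
  walk-start (here u∈) = u∈
  walk-start (step u∈ _ _) = u∈

  walk-end : ∀ {u v} → Walk E X Y u v → InVS X Y v
  walk-end (here v∈) = v∈
  walk-end (step _ _ w) = walk-end w

  _++ʷ_ : ∀ {u v w} → Walk E X Y u v → Walk E X Y v w → Walk E X Y u w
  here _       ++ʷ w′ = w′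
  step u∈ uv w ++ʷ w′ = step u∈ uv (w ++ʷ w′)

  Adj-sym : ∀ u v → Adj E u v → Adj E v u
  Adj-sym (inj₁ a) (inj₂ b) e = e
  Adj-sym (inj₂ b) (inj₁ a) e = e

  reverseʷ : ∀ {u v} → Walk E X Y u v → Walk E X Y v u
  reverseʷ (here u∈)      = here u∈
  reverseʷ (step {u} {v} u∈ uv w) = reverseʷ w ++ʷ step (walk-start w) (Adj-sym u v uv) (here u∈)

∣p∣≡∣q∣+∣p─q∣ : ∀ {k} {p q : Subset k} → q ⊆ p → ∣ p ∣ ≡ ∣ q ∣ + ∣ p ─ q ∣
∣p∣≡∣q∣+∣p─q∣ {p = []}        {[]}        _   = refl
∣p∣≡∣q∣+∣p─q∣ {p = true  ∷ p} {true  ∷ q} q⊆p = cong suc (∣p∣≡∣q∣+∣p─q∣ (drop-∷-⊆ q⊆p))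
∣p∣≡∣q∣+∣p─q∣ {p = true  ∷ p} {false ∷ q} q⊆p =
  trans (cong suc (∣p∣≡∣q∣+∣p─q∣ (drop-∷-⊆ q⊆p))) (sym (+-suc ∣ q ∣ ∣ p ─ q ∣))
∣p∣≡∣q∣+∣p─q∣ {p = false ∷ p} {true  ∷ q} q⊆p with q⊆p here
... | ()
∣p∣≡∣q∣+∣p─q∣ {p = false ∷ p} {false ∷ q} q⊆p = ∣p∣≡∣q∣+∣p─q∣ (drop-∷-⊆ q⊆p)

module Saturation {m} (F : Subset m → Subset m) (F-inflationary : ∀ R → R ⊆ F R) where

  grows? : (R : Subset m) → Dec (∃ λ x → x ∈ₛ F R × x ∉ₛ R)
  grows? R = any? (λ x → (x ∈? F R) ×-dec ¬? (x ∈? R))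

  saturate : ℕ → Subset m → Subset m
  saturate zero    R = R
  saturate (suc k) R with grows? R
  ... | yes _ = saturate k (F R)
  ... | no  _ = R

  -- Each growing step adds an element, so m steps suffice from any start.
  saturate-closed : ∀ k R → m ≤ k + ∣ R ∣ → F (saturate k R) ⊆ saturate k R
  saturate-closed zero R m≤∣R∣ {x} _ =
    subst (x ∈ₛ_) (sym (∣p∣≡n⇒p≡⊤ (≤-antisym (∣p∣≤n R) m≤∣R∣))) ∈⊤
  saturate-closed (suc k) R m≤ {x} with grows? R
  ... | no  stuck = λ x∈FR → decidable-stable (x ∈? R) (λ x∉R → stuck (x , x∈FR , x∉R))
  ... | yes (y , y∈FR , y∉R) = saturate-closed k (F R) (begin
        m                  ≤⟨ m≤ ⟩
        suc k + ∣ R ∣      ≡⟨ sym (+-suc k ∣ R ∣) ⟩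
        k + suc ∣ R ∣      ≤⟨ +-monoʳ-≤ k (p⊂q⇒∣p∣<∣q∣ (F-inflationary R , y , y∈FR , y∉R)) ⟩
        k + ∣ F R ∣        ∎)
    where open ≤-Reasoning

  saturate-ind : (P : Subset m → Set) → (∀ {R} → P R → P (F R)) → ∀ k {R} → P R → P (saturate k R)
  saturate-ind P preserve zero    pR = pR
  saturate-ind P preserve (suc k) {R} pR with grows? R
  ... | yes _ = saturate-ind P preserve k (preserve pR)
  ... | no  _ = pR

RatioMinimal : ∀ {m n} → BipGraph m n → Subset n → Subset m → Set
RatioMinimal E Y S = ∀ T → T ⊂ S → Nonempty T → ¬ RatioGE E Y T S

mediant-bound : ∀ r t nr nt {s ns} → s ≡ r + t → ns ≡ nr + nt →
  r * ns < s * nr → t * ns < s * nt → ⊥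
mediant-bound r t nr nt refl refl r< t< = <-irrefl sums-equal (+-mono-< r< t<)
  where
  sums-equal : r * (nr + nt) + t * (nr + nt) ≡ (r + t) * nr + (r + t) * nt
  sums-equal = trans (sym (*-distribʳ-+ (nr + nt) r t)) (*-distribˡ-+ (r + t) nr nt)

unsplittable : ∀ {m n} (E : BipGraph m n) (Y : Subset n) {S R} → RatioMinimal E Y S →
  R ⊆ S → Nonempty R → Nonempty (S ─ R) →
  (∀ {b} → b ∈ₛ Nbhd E Y R → b ∈ₛ Nbhd E Y (S ─ R) → ⊥) → ⊥
unsplittable E Y {S} {R} minimal R⊆S (a , a∈R) (x , x∈S─R) disjoint =
  mediant-bound (∣ R ∣) (∣ S ─ R ∣) (∣ Nbhd E Y R ∣) (∣ Nbhd E Y (S ─ R) ∣) (∣p∣≡∣q∣+∣p─q∣ R⊆S) split-N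
    (≰⇒> (minimal R (R⊆S , x , p─q⊆p S R x∈S─R , x∈p─q⇒x∉q x∈S─R) (a , a∈R)))
    (≰⇒> (minimal (S ─ R) (p─q⊆p S R , a , R⊆S a∈R , λ a∈S─R → x∈p─q⇒x∉q a∈S─R a∈R) (x , x∈S─R)))
  where
  split-N : ∣ Nbhd E Y S ∣ ≡ ∣ Nbhd E Y R ∣ + ∣ Nbhd E Y (S ─ R) ∣
  split-N = trans (∣p∣≡∣q∣+∣p─q∣ (Nbhd-mono E Y R⊆S))
                  (cong (λ N → ∣ Nbhd E Y R ∣ + ∣ N ∣) (sym (Nbhd-difference E Y {S} {R} disjoint)))

module RatioPair {m n} (E : BipGraph m n) (Y : Subset n) (S : Subset m) where

  NS : Subset n
  NS = Nbhd E Y S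

  -- Add to R every vertex of S sharing a neighbour with R.
  grow : Subset m → Subset m
  grow R = R ∪ Nbhd (flip E) S (Nbhd E Y R)

  open Saturation grow (λ R → p⊆p∪q _)

  ReachableFrom : Fin m → Subset m → Set
  ReachableFrom a R = ∀ {x} → x ∈ₛ R → Walk E S NS (inj₁ a) (inj₁ x)

  -- A new vertex x is reached via a common neighbour b with some y ∈ R.
  grow-reachable : ∀ {a R} → ReachableFrom a R → ReachableFrom a (grow R)
  grow-reachable {R = R} reach x∈ with x∈p∪q⁻ R _ x∈
  ... | inj₁ x∈R = reach x∈R
  ... | inj₂ x∈new with Nbhd⁻ (flip E) S x∈new
  ...   | x∈S , b , b∈NR , exb with Nbhd⁻ E Y b∈NR
  ...     | _ , y , y∈R , eyb =
    reach y∈R ++ʷ step {v = inj₂ b} (walk-end (reach y∈R)) eyb (step b∈NS exb (here x∈S))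
    where b∈NS = Nbhd-mono E Y (λ y∈ → walk-end (reach y∈)) b∈NR

  component : Fin m → Subset m
  component a = saturate m ⁅ a ⁆

  component-reachable : ∀ {a} → a ∈ₛ S → ReachableFrom a (component a)
  component-reachable {a} a∈S = saturate-ind (ReachableFrom a) grow-reachable m from-singleton
    where
    from-singleton : ReachableFrom a ⁅ a ⁆
    from-singleton y∈ rewrite x∈⁅y⁆⇒x≡y a y∈ = here a∈S

  component-contains : ∀ a → a ∈ₛ component a
  component-contains a = saturate-ind (a ∈ₛ_) (p⊆p∪q _) m (x∈⁅x⁆ a)

  -- The component and the rest of S have disjoint neighbourhoods, since
  -- the component is closed under 'grow'.
  component-separated : ∀ a {b} → b ∈ₛ Nbhd E Y (component a) → b ∈ₛ Nbhd E Y (S ─ component a) → ⊥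
  component-separated a b∈NC b∈N′ with Nbhd⁻ E Y b∈N′
  ... | _ , z , z∈S─C , ezb =
    x∈p─q⇒x∉q z∈S─C (closed (q⊆p∪q C _ (Nbhd⁺ (flip E) S (p─q⊆p S C z∈S─C) b∈NC ezb)))
    where
    C = component a
    closed : grow C ⊆ C
    closed = saturate-closed m ⁅ a ⁆ (m≤m+n m _)

  reach-all : RatioMinimal E Y S → ∀ {a x} → a ∈ₛ S → x ∈ₛ S → Walk E S NS (inj₁ a) (inj₁ x)
  reach-all minimal {a} {x} a∈S x∈S with x ∈? component a
  ... | yes x∈C = component-reachable a∈S x∈C
  ... | no  x∉C = ⊥-elim (unsplittable E Y minimal C⊆S (a , component-contains a)
                           (x , x∈p∧x∉q⇒x∈p─q x∈S x∉C) (component-separated a))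
    where
    C⊆S : component a ⊆ S
    C⊆S y∈C = walk-end (component-reachable a∈S y∈C)

  induced-connected : RatioMinimal E Y S → Nonempty S → InducedConnected E S NS
  induced-connected minimal (a , a∈S) u v u∈ v∈ = reverseʷ (from-a u u∈) ++ʷ from-a v v∈
    where
    from-a : ∀ w → InVS S NS w → Walk E S NS (inj₁ a) w
    from-a (inj₁ x) x∈S = reach-all minimal {a} a∈S x∈S
    from-a (inj₂ b) b∈NS with Nbhd⁻ E Y b∈NS
    ... | _ , x , x∈S , exb = from-a (inj₁ x) x∈S ++ʷ step x∈S exb (here b∈NS)

singletonA-connected : ∀ {m n} (E : BipGraph m n) a → InducedConnected E ⁅ a ⁆ ∅
singletonA-connected E a (inj₁ x) (inj₁ y) x∈ y∈
  rewrite x∈⁅y⁆⇒x≡y a x∈ | x∈⁅y⁆⇒x≡y a y∈ = here (x∈⁅x⁆ a)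
singletonA-connected E a (inj₁ x) (inj₂ y) x∈ y∈ = ⊥-elim (∉⊥ y∈)
singletonA-connected E a (inj₂ x) v        x∈ v∈ = ⊥-elim (∉⊥ x∈)

singletonB-connected : ∀ {m n} (E : BipGraph m n) b → InducedConnected E ∅ ⁅ b ⁆
singletonB-connected E b (inj₂ x) (inj₂ y) x∈ y∈
  rewrite x∈⁅y⁆⇒x≡y b x∈ | x∈⁅y⁆⇒x≡y b y∈ = here (x∈⁅x⁆ b)
singletonB-connected E b (inj₂ x) (inj₁ y) x∈ y∈ = ⊥-elim (∉⊥ y∈)
singletonB-connected E b (inj₁ x) v        x∈ v∈ = ⊥-elim (∉⊥ x∈)

run-connected : ∀ {m n} {E : BipGraph m n} {remA remB ps} → KMRun E remA remB ps →
  ∀ {Ai Bi} → (Ai , Bi) ∈ ps → InducedConnected E Ai Bi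
run-connected (done _ _) ()
run-connected {E = E} (isoStep a _ _ _) (here refl) = singletonA-connected E a
run-connected (isoStep _ _ _ run) (there p) = run-connected run p
run-connected {E = E} (ratioStep {remB = Y} S _ _ nonempty _ minimal _) (here refl) =
  RatioPair.induced-connected E Y S minimal nonempty
run-connected (ratioStep _ _ _ _ _ _ run) (there p) = run-connected run p
run-connected {E = E} (bStep b _ _ _) (here refl) = singletonB-connected E b
run-connected (bStep _ _ _ run) (there p) = run-connected run p

lemma1 : (m n : ℕ) (E : BipGraph m n) (ps : List (Subset m × Subset n)) →
    IsKMOutput E ps →
    (Ai : Subset m) (Bi : Subset n) → (Ai , Bi) ∈ ps →
    InducedConnected E Ai Bi
lemma1 m n E ps run Ai Bi = run-connected run
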